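{- (1) Let $M$ be a finite meadow with cardinality $n$. Then $M$ is minimal if and only if there exist distinct primes $p_1,\ldots,p_k$ such that \[ M\cong \mathbb{Z}/p_1\mathbb{Z}\times\cdots\times\mathbb{Z}/p_k\mathbb{Z} \] and $n=p_1\cdots p_k$. (2) Any two finite minimal meadows of the same cardinality are isomorphic.
   Context: A commutative ring is a structure $\langle R,+,-,\cdot,0,1\rangle$ satisfying the usual axioms of a commutative ring with identity $1$. For $x\in R$, an element $y$ with $x\cdot x\cdot y=x$ and $y\cdot y\cdot x=y$ is unique if it exists; it is the generalized inverse $x^{ -1}$ of $x$. A meadow is a commutative ring in which every element has a generalized inverse, viewed as an algebra with operations $+,-,\cdot,{}^{ -1},0,1$. A meadow is minimal if it contains no proper submeadow (proper subset closed under all these operations and containing $0,1$). Each $\mathbb{Z}/p\mathbb{Z}$ is regarded as a meadow with $0^{ -1}=0$; products carry componentwise operations. -}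

module Defs where

open import Level using (Level; _⊔_) renaming (suc to lsuc)
open import Data.Nat using (ℕ; zero; suc; NonZero)
import Data.Nat as ℕ
open import Data.Nat.DivMod using (_mod_)
open import Data.Fin using (Fin; toℕ) renaming (zero to fzero; suc to fsuc)
open import Data.Product using (Σ; ∃; _×_; _,_)
open import Relation.Nullary using (¬_)
open import Relation.Unary using (Pred)
open import Relation.Binary using (Setoid; IsEquivalence)
open import Relation.Binary.PropositionalEquality as ≡ using (_≡_)
open import Algebra.Bundles using (CommutativeRing)
open import Function.Bundles using (Bijection)

record RawMeadow (c ℓ : Level) : Set (lsuc (c ⊔ ℓ)) where
  infixl 6 _+_
  infixl 7 _*_
  infix 8 -_
  infix 9 _⁻¹
  infix 4 _≈_
  field
    Carrier       : Set c
    _≈_           : Carrier → Carrier → Set ℓ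
    isEquivalence : IsEquivalence _≈_
    _+_           : Carrier → Carrier → Carrier
    _*_           : Carrier → Carrier → Carrier
    -_            : Carrier → Carrier
    _⁻¹           : Carrier → Carrier
    0#            : Carrier
    1#            : Carrier

  setoid : Setoid c ℓ
  setoid = record { isEquivalence = isEquivalence }

record Meadow (c ℓ : Level) : Set (lsuc (c ⊔ ℓ)) where
  field
    commutativeRing : CommutativeRing c ℓ
  open CommutativeRing commutativeRing public
  infix 9 _⁻¹
  field
    _⁻¹      : Carrier → Carrier
    inv-law₁ : ∀ x → x * x * (x ⁻¹) ≈ x
    inv-law₂ : ∀ x → (x ⁻¹) * (x ⁻¹) * x ≈ x ⁻¹

  raw : RawMeadow c ℓ
  raw = record
    { Carrier = Carrier ; _≈_ = _≈_ ; isEquivalence = isEquivalence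
    ; _+_ = _+_ ; _*_ = _*_ ; -_ = -_ ; _⁻¹ = _⁻¹ ; 0# = 0# ; 1# = 1# }

record _≅_ {a ℓa b ℓb} (A : RawMeadow a ℓa) (B : RawMeadow b ℓb)
       : Set (a ⊔ ℓa ⊔ b ⊔ ℓb) where
  module A = RawMeadow A
  module B = RawMeadow B
  field
    bijection : Bijection A.setoid B.setoid
  open Bijection bijection public using (to)
  field
    to-+   : ∀ x y → to (x A.+ y) B.≈ to x B.+ to y
    to-*   : ∀ x y → to (x A.* y) B.≈ to x B.* to y
    to--   : ∀ x → to (A.- x) B.≈ B.- to x
    to-⁻¹  : ∀ x → to (x A.⁻¹) B.≈ (to x) B.⁻¹
    to-0   : to A.0# B.≈ B.0#
    to-1   : to A.1# B.≈ B.1#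

HasCardinality : ∀ {c ℓ} → Meadow c ℓ → ℕ → Set (c ⊔ ℓ)
HasCardinality M n = Bijection (Meadow.setoid M) (≡.setoid (Fin n))

record IsSubmeadow {c ℓ} (M : Meadow c ℓ) (P : Pred (Meadow.Carrier M) (c ⊔ ℓ))
       : Set (c ⊔ ℓ) where
  open Meadow M
  field
    resp  : ∀ {x y} → x ≈ y → P x → P y
    has-0 : P 0#
    has-1 : P 1#
    cl-+  : ∀ {x y} → P x → P y → P (x + y)
    cl-*  : ∀ {x y} → P x → P y → P (x * y)
    cl--  : ∀ {x} → P x → P (- x)
    cl-⁻¹ : ∀ {x} → P x → P (x ⁻¹)

IsMinimal : ∀ {c ℓ} → Meadow c ℓ → Set (lsuc (c ⊔ ℓ))
IsMinimal {c} {ℓ} M =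
  ∀ (P : Pred (Meadow.Carrier M) (c ⊔ ℓ)) → IsSubmeadow M P →
    ¬ (Σ (Meadow.Carrier M) λ x → ¬ P x)

-- The meadow Z/qZ on Fin q (q ≠ 0), with 0⁻¹ = 0 and, for x ≠ 0,
-- x⁻¹ = x^(q-2) mod q (the field inverse when q is prime).

module ZMod (q : ℕ) .{{_ : NonZero q}} where
  _+q_ : Fin q → Fin q → Fin q
  x +q y = (toℕ x ℕ.+ toℕ y) mod q
  _*q_ : Fin q → Fin q → Fin q
  x *q y = (toℕ x ℕ.* toℕ y) mod q
  -q_ : Fin q → Fin q
  -q x = (q ℕ.∸ toℕ x) mod q
  invq : Fin q → Fin q
  invq fzero    = fzero
  invq (fsuc i) = (toℕ (fsuc i) ℕ.^ (q ℕ.∸ 2)) mod q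
  0q : Fin q
  0q = 0 mod q
  1q : Fin q
  1q = 1 mod q

ZProd : ∀ {k} (p : Fin k → ℕ) → (∀ i → NonZero (p i)) → RawMeadow Level.zero Level.zero
ZProd {k} p nz = record
  { Carrier = (i : Fin k) → Fin (p i)
  ; _≈_ = λ x y → ∀ i → x i ≡ y i
  ; isEquivalence = record
      { refl = λ i → ≡.refl
      ; sym = λ e i → ≡.sym (e i)
      ; trans = λ e f i → ≡.trans (e i) (f i) }
  ; _+_ = λ x y i → let instance _ = nz i in ZMod._+q_ (p i) (x i) (y i)
  ; _*_ = λ x y i → let instance _ = nz i in ZMod._*q_ (p i) (x i) (y i)
  ; -_  = λ x i → let instance _ = nz i in ZMod.-q_ (p i) (x i)
  ; _⁻¹ = λ x i → let instance _ = nz i in ZMod.invq (p i) (x i)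
  ; 0#  = λ i → let instance _ = nz i in ZMod.0q (p i)
  ; 1#  = λ i → let instance _ = nz i in ZMod.1q (p i)
  }

∏ : ∀ {k} → (Fin k → ℕ) → ℕ
∏ {zero}  p = 1
∏ {suc k} p = p fzero ℕ.* ∏ (λ i → p (fsuc i))

module Submission where

-- Write ι a = a·1. In a finite meadow some power x^(d+2) equals x, which makes x⁻¹ a polynomial in x;
-- so the image of ι is a submeadow, and minimality forces ι to be onto. Hence a finite minimal meadow M
-- is ℕ modulo the additive order of 1, and counting shows that order is |M|. A meadow has no nonzero
-- nilpotents, so |M| is squarefree, |M| = p₁⋯p_k with distinct primes. The product of the fields Z/p_iZ
-- is presented by ℕ modulo p₁⋯p_k in the same way (Chinese remainder theorem by counting, Fermat's little
-- theorem for the inverse), and two meadows presented by ℕ modulo the same number are isomorphic.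
-- Conversely every element of ∏ Z/p_iZ, hence of any meadow isomorphic to it, has the form a·1, so such a
-- meadow is minimal.

open import Defs
open import Level using (Level; _⊔_)
open import Data.Nat using (ℕ; NonZero)
open import Data.Nat.Primality using (Prime; prime⇒nonZero)
open import Data.Fin using (Fin)
open import Data.Product using (Σ; _×_; _,_)
open import Function.Bundles using (_⇔_; mk⇔)
open import Relation.Binary.PropositionalEquality using (_≡_)

module ModularArithmetic where

  open import Data.Nat
  open import Data.Nat.Properties
  open import Data.Nat.DivMod
  open import Data.Nat.Divisibility
  open import Data.Nat.Primality using (Prime; euclidsLemma)
  open import Data.Fin using (toℕ)
  import Data.Fin.Properties as Fin
  open import Data.Sum using (inj₁; inj₂)
  open import Relation.Nullary using (¬_; contradiction)
  open import Relation.Binary.PropositionalEquality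

  module _ {d : ℕ} .{{_ : NonZero d}} where

    %-≡⇒∣∣-∣ : ∀ a b → a % d ≡ b % d → d ∣ ∣ a - b ∣
    %-≡⇒∣∣-∣ a b eq = divides ∣ a / d - b / d ∣ (begin
      ∣ a - b ∣                                   ≡⟨ cong₂ ∣_-_∣ (m≡m%n+[m/n]*n a d) (m≡m%n+[m/n]*n b d) ⟩
      ∣ a % d + a / d * d - b % d + b / d * d ∣   ≡⟨ cong (λ r → ∣ r + a / d * d - b % d + b / d * d ∣) eq ⟩
      ∣ b % d + a / d * d - b % d + b / d * d ∣   ≡⟨ ∣m+n-m+o∣≡∣n-o∣ (b % d) _ _ ⟩
      ∣ a / d * d - b / d * d ∣                   ≡⟨ *-distribʳ-∣-∣ d (a / d) (b / d) ⟨
      ∣ a / d - b / d ∣ * d                       ∎)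
      where open ≡-Reasoning

    ≤∧∣∸⇒%-≡ : ∀ {a b} → a ≤ b → d ∣ b ∸ a → b % d ≡ a % d
    ≤∧∣∸⇒%-≡ {a} a≤b d∣b∸a = trans (cong (_% d) (sym (m+[n∸m]≡n a≤b))) (%-remove-+ʳ a d∣b∸a)

    ∣∣-∣⇒%-≡ : ∀ a b → d ∣ ∣ a - b ∣ → a % d ≡ b % d
    ∣∣-∣⇒%-≡ a b d∣ with ≤-total a b
    ... | inj₁ a≤b = sym (≤∧∣∸⇒%-≡ a≤b (subst (d ∣_) (m≤n⇒∣m-n∣≡n∸m a≤b) d∣))
    ... | inj₂ b≤a = ≤∧∣∸⇒%-≡ b≤a (subst (d ∣_) (m≤n⇒∣n-m∣≡n∸m b≤a) d∣)

    %-cong-+ : ∀ {a b c e} → a % d ≡ b % d → c % d ≡ e % d → (a + c) % d ≡ (b + e) % d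
    %-cong-+ {a} {b} {c} {e} a≡b c≡e = begin
      (a + c) % d            ≡⟨ %-distribˡ-+ a c d ⟩
      (a % d + c % d) % d    ≡⟨ cong₂ (λ u v → (u + v) % d) a≡b c≡e ⟩
      (b % d + e % d) % d    ≡⟨ %-distribˡ-+ b e d ⟨
      (b + e) % d            ∎
      where open ≡-Reasoning

    %-cong-* : ∀ {a b c e} → a % d ≡ b % d → c % d ≡ e % d → (a * c) % d ≡ (b * e) % d
    %-cong-* {a} {b} {c} {e} a≡b c≡e = begin
      (a * c) % d            ≡⟨ %-distribˡ-* a c d ⟩
      (a % d * (c % d)) % d  ≡⟨ cong₂ (λ u v → (u * v) % d) a≡b c≡e ⟩
      (b % d * (e % d)) % d  ≡⟨ %-distribˡ-* b e d ⟨
      (b * e) % d            ∎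
      where open ≡-Reasoning

    %-cong-^ : ∀ {a b} n → a % d ≡ b % d → (a ^ n) % d ≡ (b ^ n) % d
    %-cong-^ zero    a≡b = refl
    %-cong-^ (suc n) a≡b = %-cong-* a≡b (%-cong-^ n a≡b)

    %-cancelʳ-+ : ∀ {a b} c → (a + c) % d ≡ (b + c) % d → a % d ≡ b % d
    %-cancelʳ-+ {a} {b} c eq = ∣∣-∣⇒%-≡ a b (subst (d ∣_) ∣a+c-b+c∣≡∣a-b∣ (%-≡⇒∣∣-∣ _ _ eq))
      where
      ∣a+c-b+c∣≡∣a-b∣ : ∣ a + c - b + c ∣ ≡ ∣ a - b ∣
      ∣a+c-b+c∣≡∣a-b∣ = trans (cong₂ ∣_-_∣ (+-comm a c) (+-comm b c)) (∣m+n-m+o∣≡∣n-o∣ c a b)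

    %-cancelˡ-* : ∀ {a b c} → Prime d → ¬ d ∣ c → (c * a) % d ≡ (c * b) % d → a % d ≡ b % d
    %-cancelˡ-* {a} {b} {c} d-prime d∤c eq
      with euclidsLemma c ∣ a - b ∣ d-prime (subst (d ∣_) (sym (*-distribˡ-∣-∣ c a b)) (%-≡⇒∣∣-∣ _ _ eq))
    ... | inj₁ d∣c  = contradiction d∣c d∤c
    ... | inj₂ d∣∣a-b∣ = ∣∣-∣⇒%-≡ a b d∣∣a-b∣

  toℕ-mod : ∀ a d .{{_ : NonZero d}} → toℕ (a mod d) ≡ a % d
  toℕ-mod a d = Fin.toℕ-fromℕ< (m%n<n a d)

  %-≡⇒mod-≡ : ∀ {a b d} .{{_ : NonZero d}} → a % d ≡ b % d → a mod d ≡ b mod d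
  %-≡⇒mod-≡ {a} {b} {d} eq = Fin.toℕ-injective (trans (toℕ-mod a d) (trans eq (sym (toℕ-mod b d))))

  mod-≡⇒%-≡ : ∀ {a b d} .{{_ : NonZero d}} → a mod d ≡ b mod d → a % d ≡ b % d
  mod-≡⇒%-≡ {a} {b} {d} eq = trans (sym (toℕ-mod a d)) (trans (cong toℕ eq) (toℕ-mod b d))

  %-≡-∣ : ∀ {m n} .{{_ : NonZero m}} .{{_ : NonZero n}} → m ∣ n → ∀ {a b} → a % n ≡ b % n → a % m ≡ b % m
  %-≡-∣ {m} {n} m∣n {a} {b} a≡b = trans (sym (m∣n⇒o%n%m≡o%m m n a m∣n)) (trans (cong (_% m) a≡b) (m∣n⇒o%n%m≡o%m m n b m∣n))

module Fermat where

  open import Data.Nat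
  open import Data.Nat.Properties
  open import Data.Nat.DivMod
  open import Data.Nat.Divisibility
  open import Data.Nat.Primality
  open import Data.Nat.Combinatorics using (_C_; nCn≡1; nCk≡n!/k![n-k]!; k![n∸k]!∣n!)
  open import Data.Fin using (toℕ; fromℕ; inject₁) renaming (zero to fzero; suc to fsuc)
  import Data.Fin.Properties as Fin
  open import Data.Vec.Functional using (Vector; init)
  open import Data.Product using (_×_; _,_)
  open import Data.Sum using (inj₁; inj₂; [_,_]′)
  open import Relation.Nullary using (¬_; contradiction)
  open import Relation.Binary.PropositionalEquality
  open import Function using (_∘_; id)
  import Algebra.Properties.CommutativeSemiring.Binomial +-*-commutativeSemiring as Binomial
  import Algebra.Properties.Semiring.Exp +-*-semiring as Exp
  import Algebra.Properties.Semiring.Mult +-*-semiring as Mult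
  import Algebra.Properties.Monoid.Sum +-0-monoid as Sum
  open ModularArithmetic

  prime∤m! : ∀ {p} m → Prime p → m < p → ¬ p ∣ m !
  prime∤m! zero    p-prime _   p∣1 = ¬prime[1] (subst Prime (∣1⇒≡1 p∣1) p-prime)
  prime∤m! (suc m) p-prime m<p p∣m! with euclidsLemma (suc m) (m !) p-prime p∣m!
  ... | inj₁ p∣1+m = <⇒≱ m<p (∣⇒≤ p∣1+m)
  ... | inj₂ p∣m!  = prime∤m! m p-prime (<-trans (n<1+n m) m<p) p∣m!

  p∣pCk : ∀ {p k} → Prime p → 0 < k → k < p → p ∣ p C k
  p∣pCk {p@(suc q)} {k} p-prime 0<k k<p =
    [ id , (λ p∣k![p∸k]! → contradiction p∣k![p∸k]! p∤k![p∸k]!) ]′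
      (euclidsLemma (p C k) (k ! * (p ∸ k) !) p-prime p∣pCk*k![p∸k]!)
    where
    instance
      k![p∸k]!≢0 : NonZero (k ! * (p ∸ k) !)
      k![p∸k]!≢0 = m*n≢0 (k !) ((p ∸ k) !) {{k !≢0}} {{(p ∸ k) !≢0}}
    p∣pCk*k![p∸k]! : p ∣ (p C k) * (k ! * (p ∸ k) !)
    p∣pCk*k![p∸k]! = subst (p ∣_) (sym (begin
      (p C k) * (k ! * (p ∸ k) !)            ≡⟨ cong (_* (k ! * (p ∸ k) !)) (nCk≡n!/k![n-k]! (<⇒≤ k<p)) ⟩
      p ! / (k ! * (p ∸ k) !) * (k ! * (p ∸ k) !) ≡⟨ m/n*n≡m (k![n∸k]!∣n! (<⇒≤ k<p)) ⟩
      p !                                  ∎)) (m∣m*n (q !))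
      where open ≡-Reasoning
    p∤k![p∸k]! : ¬ p ∣ k ! * (p ∸ k) !
    p∤k![p∸k]! p∣ = [ prime∤m! k p-prime k<p , prime∤m! (p ∸ k) p-prime (∸-monoʳ-< 0<k (<⇒≤ k<p)) ]′
      (euclidsLemma (k !) ((p ∸ k) !) p-prime p∣)

  ^-≡-Exp : ∀ x n → x Exp.^ n ≡ x ^ n
  ^-≡-Exp x zero    = refl
  ^-≡-Exp x (suc n) = cong (x *_) (^-≡-Exp x n)

  ×-≡-* : ∀ n x → n Mult.× x ≡ n * x
  ×-≡-* zero    x = refl
  ×-≡-* (suc n) x = cong (x +_) (×-≡-* n x)

  ∣-sum : ∀ {d n} (t : Vector ℕ n) → (∀ i → d ∣ t i) → d ∣ Sum.sum t
  ∣-sum {n = zero}  t d∣t = divides 0 refl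
  ∣-sum {n = suc n} t d∣t = ∣m∣n⇒∣m+n (d∣t fzero) (∣-sum (t ∘ fsuc) (d∣t ∘ fsuc))

  [1+x]^p%p≡[1+x^p]%p : ∀ {p} → Prime p → .{{_ : NonZero p}} → ∀ x → (suc x ^ p) % p ≡ suc (x ^ p) % p
  [1+x]^p%p≡[1+x^p]%p {p@(suc q)} p-prime x = begin
    (suc x ^ p) % p                         ≡⟨ cong (λ y → (y ^ p) % p) (+-comm 1 x) ⟩
    ((x + 1) ^ p) % p                       ≡⟨ cong (_% p) (trans (sym (^-≡-Exp (x + 1) p)) (Binomial.theorem p x 1)) ⟩
    Sum.sum t % p                           ≡⟨ cong (λ s → (t fzero + s) % p) (Sum.sum-init-last (t ∘ fsuc)) ⟩
    (t fzero + (Sum.sum middle + t (fromℕ p))) % p ≡⟨ cong (_% p) (x+[y+z]≡x+z+y (t fzero) _ _) ⟩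
    (t fzero + t (fromℕ p) + Sum.sum middle) % p  ≡⟨ %-remove-+ʳ (t fzero + t (fromℕ p)) (∣-sum middle p∣middle) ⟩
    (t fzero + t (fromℕ p)) % p             ≡⟨ cong₂ (λ u v → (u + v) % p) t₀≡1 tₚ≡xᵖ ⟩
    suc (x ^ p) % p                         ∎
    where
    open ≡-Reasoning
    t : Vector ℕ (suc p)
    t = Binomial.binomialTerm x 1 p
    middle : Vector ℕ q
    middle = init (t ∘ fsuc)
    x+[y+z]≡x+z+y : ∀ a b c → a + (b + c) ≡ a + c + b
    x+[y+z]≡x+z+y a b c = trans (cong (a +_) (+-comm b c)) (sym (+-assoc a c b))
    term≡ : ∀ k → t k ≡ (p C toℕ k) * (x ^ toℕ k * 1 ^ (p ∸ toℕ k))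
    term≡ k = trans (×-≡-* (p C toℕ k) _) (cong ((p C toℕ k) *_) (cong₂ _*_ (^-≡-Exp x (toℕ k)) (^-≡-Exp 1 (p ∸ toℕ k))))
    t₀≡1 : t fzero ≡ 1
    t₀≡1 = trans (term≡ fzero) (trans (+-identityʳ _) (trans (*-identityˡ _) (^-zeroˡ p)))
    tₚ≡xᵖ : t (fromℕ p) ≡ x ^ p
    tₚ≡xᵖ = begin
      t (fromℕ p) ≡⟨ term≡ (fromℕ p) ⟩
      (p C toℕ (fromℕ p)) * (x ^ toℕ (fromℕ p) * 1 ^ (p ∸ toℕ (fromℕ p)))
        ≡⟨ cong (λ k → (p C k) * (x ^ k * 1 ^ (p ∸ k))) (Fin.toℕ-fromℕ p) ⟩
      (p C p) * (x ^ p * 1 ^ (p ∸ p))  ≡⟨ cong₂ (λ c e → c * (x ^ p * 1 ^ e)) (nCn≡1 p) (n∸n≡0 p) ⟩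
      1 * (x ^ p * 1)               ≡⟨ trans (*-identityˡ _) (*-identityʳ _) ⟩
      x ^ p ∎
    p∣middle : ∀ i → p ∣ middle i
    p∣middle i = subst (p ∣_) (sym (term≡ (fsuc (inject₁ i))))
      (∣m⇒∣m*n _ (p∣pCk p-prime z<s (s<s (subst (_< q) (sym (Fin.toℕ-inject₁ i)) (Fin.toℕ<n i)))))

  fermat : ∀ {p} → Prime p → .{{_ : NonZero p}} → ∀ x → (x ^ p) % p ≡ x % p
  fermat {suc _} p-prime zero    = refl
  fermat {p}     p-prime (suc x) = trans ([1+x]^p%p≡[1+x^p]%p p-prime x) (%-cong-+ {a = 1} refl (fermat p-prime x))

  fermat-unit : ∀ {p} → Prime p → .{{_ : NonZero p}} → ∀ {x} → ¬ p ∣ x → (x * x ^ (p ∸ 2)) % p ≡ 1 % p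
  fermat-unit {p@(suc (suc r))} p-prime {x} p∤x =
    %-cancelˡ-* p-prime p∤x (trans (fermat p-prime x) (cong (_% p) (sym (*-identityʳ x))))
  fermat-unit {1} p-prime = contradiction p-prime ¬prime[1]

  GenInverseMod : (d : ℕ) .{{_ : NonZero d}} → ℕ → ℕ → Set
  GenInverseMod d a b = (a * a * b) % d ≡ a % d × (b * b * a) % d ≡ b % d

  module _ {d : ℕ} .{{_ : NonZero d}} {a b : ℕ} where

    genInverse-of-multiple : d ∣ a → GenInverseMod d a b → b % d ≡ 0
    genInverse-of-multiple d∣a (_ , bba≡b) = begin
      b % d             ≡⟨ bba≡b ⟨
      (b * b * a) % d   ≡⟨ %-cong-* {a = b * b} refl (trans (n∣m⇒m%n≡0 a d d∣a) (sym (m*n%n≡0 0 d))) ⟩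
      (b * b * 0) % d   ≡⟨ cong (_% d) (*-zeroʳ (b * b)) ⟩
      0 % d             ≡⟨ m*n%n≡0 0 d ⟩
      0                 ∎
      where open ≡-Reasoning

    genInverse-of-unit : Prime d → ¬ d ∣ a → GenInverseMod d a b → b % d ≡ (a ^ (d ∸ 2)) % d
    genInverse-of-unit d-prime d∤a (aab≡a , _) = begin
      b % d                      ≡⟨ cong (_% d) (*-identityʳ b) ⟨
      (b * 1) % d                ≡⟨ %-cong-* {a = b} refl (fermat-unit d-prime d∤a) ⟨
      (b * (a * a ^ (d ∸ 2))) % d ≡⟨ cong (_% d) (x*[y*z]≡[y*x]*z b a _) ⟩
      (a * b * a ^ (d ∸ 2)) % d  ≡⟨ %-cong-* ab≡1 refl ⟩
      (1 * a ^ (d ∸ 2)) % d      ≡⟨ cong (_% d) (*-identityˡ _) ⟩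
      (a ^ (d ∸ 2)) % d          ∎
      where
      open ≡-Reasoning
      x*[y*z]≡[y*x]*z : ∀ x y z → x * (y * z) ≡ y * x * z
      x*[y*z]≡[y*x]*z x y z = trans (sym (*-assoc x y z)) (cong (_* z) (*-comm x y))
      ab≡1 : (a * b) % d ≡ 1 % d
      ab≡1 = %-cancelˡ-* d-prime d∤a
        (trans (cong (_% d) (sym (*-assoc a a b))) (trans aab≡a (cong (_% d) (sym (*-identityʳ a)))))

module MeadowProperties {c ℓ} (M : Meadow c ℓ) where

  open import Data.Nat as ℕ using (ℕ; zero; suc; NonZero; _%_; _/_; _∸_)
  open import Data.Nat.DivMod using (m≡m%n+[m/n]*n)
  open import Data.Nat.Properties using (m+[n∸m]≡n)
  open import Relation.Binary.PropositionalEquality as ≡ using (_≡_)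
  open import Data.Product using (∃; _,_)
  open Fermat using (GenInverseMod)

  open Meadow M
  open import Algebra.Properties.Semiring.Mult semiring using (×-homo-1; ×-homo-+; ×1-homo-*)
  import Algebra.Properties.Semiring.Mult semiring as Mult
  open import Algebra.Properties.Ring ring using (+-inverseʳ-unique)
  open import Algebra.Solver.CommutativeMonoid *-commutativeMonoid using (solve; _⊕_; _⊜_)
  open import Algebra.Properties.Semiring.Exp semiring using (_^_; ^-homo-*)
  open import Relation.Binary.Reasoning.Setoid setoid

  ⁻¹-unique : ∀ {x y} → x * x * y ≈ x → y * y * x ≈ y → y ≈ x ⁻¹
  ⁻¹-unique {x} {y} xxy≈x yyx≈y = begin
    y               ≈⟨ yyx≈y ⟨
    y * y * x       ≈⟨ solve 2 (λ x y → (y ⊕ y) ⊕ x ⊜ y ⊕ (x ⊕ y)) refl x y ⟩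
    y * (x * y)     ≈⟨ *-congˡ xy≈xz ⟩
    y * (x * z)     ≈⟨ solve 3 (λ x y z → y ⊕ (x ⊕ z) ⊜ (x ⊕ y) ⊕ z) refl x y z ⟩
    x * y * z       ≈⟨ *-congʳ xy≈xz ⟩
    x * z * z       ≈⟨ solve 2 (λ x z → (x ⊕ z) ⊕ z ⊜ (z ⊕ z) ⊕ x) refl x z ⟩
    z * z * x       ≈⟨ inv-law₂ x ⟩
    z               ∎
    where
    z : Carrier
    z = x ⁻¹
    idempotents-agree : ∀ {u v} → x * x * u ≈ x → x * x * v ≈ x → x * u ≈ x * v
    idempotents-agree {u} {v} xxu≈x xxv≈x = begin
      x * u             ≈⟨ *-congʳ xxv≈x ⟨
      x * x * v * u     ≈⟨ solve 3 (λ x u v → ((x ⊕ x) ⊕ v) ⊕ u ⊜ ((x ⊕ x) ⊕ u) ⊕ v) refl x u v ⟩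
      x * x * u * v     ≈⟨ *-congʳ xxu≈x ⟩
      x * v             ∎
    xy≈xz : x * y ≈ x * z
    xy≈xz = idempotents-agree xxy≈x (inv-law₁ x)

  x*x≈0⇒x≈0 : ∀ {x} → x * x ≈ 0# → x ≈ 0#
  x*x≈0⇒x≈0 {x} xx≈0 = trans (sym (inv-law₁ x)) (trans (*-congʳ xx≈0) (zeroˡ _))

  x*x*u≈x⇒x⁻¹≈u*u*x : ∀ {x u} → x * x * u ≈ x → x ⁻¹ ≈ u * u * x
  x*x*u≈x⇒x⁻¹≈u*u*x {x} {u} xxu≈x = sym (⁻¹-unique xxy≈x yyx≈y)
    where
    xxy≈x : x * x * (u * u * x) ≈ x
    xxy≈x = begin
      x * x * (u * u * x)   ≈⟨ solve 2 (λ x u → (x ⊕ x) ⊕ ((u ⊕ u) ⊕ x) ⊜ ((x ⊕ x) ⊕ u) ⊕ (u ⊕ x)) refl x u ⟩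
      x * x * u * (u * x)   ≈⟨ *-congʳ xxu≈x ⟩
      x * (u * x)           ≈⟨ solve 2 (λ x u → x ⊕ (u ⊕ x) ⊜ (x ⊕ x) ⊕ u) refl x u ⟩
      x * x * u             ≈⟨ xxu≈x ⟩
      x                     ∎
    yyx≈y : u * u * x * (u * u * x) * x ≈ u * u * x
    yyx≈y = begin
      u * u * x * (u * u * x) * x    ≈⟨ solve 2 (λ x u → (((u ⊕ u) ⊕ x) ⊕ ((u ⊕ u) ⊕ x)) ⊕ x ⊜ ((x ⊕ x) ⊕ u) ⊕ (((x ⊕ u) ⊕ u) ⊕ u)) refl x u ⟩
      x * x * u * (x * u * u * u)    ≈⟨ *-congʳ xxu≈x ⟩
      x * (x * u * u * u)            ≈⟨ solve 2 (λ x u → x ⊕ (((x ⊕ u) ⊕ u) ⊕ u) ⊜ ((x ⊕ x) ⊕ u) ⊕ (u ⊕ u)) refl x u ⟩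
      x * x * u * (u * u)            ≈⟨ *-congʳ xxu≈x ⟩
      x * (u * u)                    ≈⟨ *-comm x (u * u) ⟩
      u * u * x                      ∎

  x^[1+t]*[x⁻¹]^t≈x : ∀ x t → x ^ suc t * (x ⁻¹) ^ t ≈ x
  x^[1+t]*[x⁻¹]^t≈x x zero    = trans (*-identityʳ _) (*-identityʳ x)
  x^[1+t]*[x⁻¹]^t≈x x (suc t) = begin
    x * x ^ suc t * (x ⁻¹ * (x ⁻¹) ^ t)  ≈⟨ solve 4 (λ x X z Z → (x ⊕ X) ⊕ (z ⊕ Z) ⊜ (X ⊕ Z) ⊕ (x ⊕ z)) refl x (x ^ suc t) (x ⁻¹) ((x ⁻¹) ^ t) ⟩
    x ^ suc t * (x ⁻¹) ^ t * (x * x ⁻¹)  ≈⟨ *-congʳ (x^[1+t]*[x⁻¹]^t≈x x t) ⟩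
    x * (x * x ⁻¹)                       ≈⟨ *-assoc x x (x ⁻¹) ⟨
    x * x * x ⁻¹                         ≈⟨ inv-law₁ x ⟩
    x                                    ∎

  x^[1+i]≈x^[1+i+1+d]⇒x*x*x^d≈x : ∀ x i d → x ^ suc i ≈ x ^ (suc i ℕ.+ suc d) → x * x * x ^ d ≈ x
  x^[1+i]≈x^[1+i+1+d]⇒x*x*x^d≈x x i d x^[1+i]≈x^[1+i+1+d] = sym (begin
    x                                        ≈⟨ x^[1+t]*[x⁻¹]^t≈x x i ⟨
    x ^ suc i * (x ⁻¹) ^ i                   ≈⟨ *-congʳ x^[1+i]≈x^[1+i+1+d] ⟩
    x ^ (suc i ℕ.+ suc d) * (x ⁻¹) ^ i       ≈⟨ *-congʳ (^-homo-* x (suc i) (suc d)) ⟩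
    x ^ suc i * x ^ suc d * (x ⁻¹) ^ i       ≈⟨ solve 3 (λ a b c → (a ⊕ b) ⊕ c ⊜ b ⊕ (a ⊕ c)) refl (x ^ suc i) (x ^ suc d) ((x ⁻¹) ^ i) ⟩
    x ^ suc d * (x ^ suc i * (x ⁻¹) ^ i)     ≈⟨ *-congˡ (x^[1+t]*[x⁻¹]^t≈x x i) ⟩
    x * x ^ d * x                            ≈⟨ solve 2 (λ x y → (x ⊕ y) ⊕ x ⊜ (x ⊕ x) ⊕ y) refl x (x ^ d) ⟩
    x * x * x ^ d                            ∎)

  ι : ℕ → Carrier
  ι a = a Mult.× 1#

  ι-^ : ∀ a d → ι (a ℕ.^ d) ≈ ι a ^ d
  ι-^ a zero    = ×-homo-1 1#
  ι-^ a (suc d) = trans (×1-homo-* a (a ℕ.^ d)) (*-congˡ (ι-^ a d))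

  ι-*³ : ∀ a b c → ι (a ℕ.* b ℕ.* c) ≈ ι a * ι b * ι c
  ι-*³ a b c = trans (×1-homo-* (a ℕ.* b) c) (*-congʳ (×1-homo-* a b))

  ι-surjective⇒minimal : (∀ x → ∃ λ a → ι a ≈ x) → IsMinimal M
  ι-surjective⇒minimal ι-surjective P P-isSubmeadow (x , x∉P)
    with a , ιa≈x ← ι-surjective x = x∉P (resp ιa≈x (ι∈P a))
    where
    open IsSubmeadow P-isSubmeadow
    ι∈P : ∀ a → P (ι a)
    ι∈P zero    = has-0
    ι∈P (suc a) = cl-+ has-1 (ι∈P a)

  module _ (N : ℕ) .{{_ : NonZero N}} (ιN≈0 : ι N ≈ 0#) where

    ι-mod : ∀ a → ι a ≈ ι (a % N)
    ι-mod a = begin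
      ι a                             ≡⟨ ≡.cong ι (m≡m%n+[m/n]*n a N) ⟩
      ι (a % N ℕ.+ a / N ℕ.* N)       ≈⟨ ×-homo-+ 1# (a % N) _ ⟩
      ι (a % N) + ι (a / N ℕ.* N)     ≈⟨ +-congˡ (×1-homo-* (a / N) N) ⟩
      ι (a % N) + ι (a / N) * ι N     ≈⟨ +-congˡ (trans (*-congˡ ιN≈0) (zeroʳ _)) ⟩
      ι (a % N) + 0#                  ≈⟨ +-identityʳ _ ⟩
      ι (a % N)                       ∎

    ι-cong-mod : ∀ {a b} → a % N ≡ b % N → ι a ≈ ι b
    ι-cong-mod {a} {b} a≡b = trans (ι-mod a) (trans (reflexive (≡.cong ι a≡b)) (sym (ι-mod b)))

    ι-neg : ∀ a → ι ((N ∸ 1) ℕ.* a) ≈ - ι a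
    ι-neg a = +-inverseʳ-unique (ι a) _ (begin
      ι a + ι ((N ∸ 1) ℕ.* a)      ≈⟨ ×-homo-+ 1# a _ ⟨
      ι (suc (N ∸ 1) ℕ.* a)        ≡⟨ ≡.cong (λ m → ι (m ℕ.* a)) (m+[n∸m]≡n (ℕ.>-nonZero⁻¹ N)) ⟩
      ι (N ℕ.* a)                  ≈⟨ ×1-homo-* N a ⟩
      ι N * ι a                    ≈⟨ trans (*-congʳ ιN≈0) (zeroˡ _) ⟩
      0#                           ∎)

    ι-genInverse : ∀ {a b} → GenInverseMod N a b → ι b ≈ ι a ⁻¹
    ι-genInverse {a} {b} (aab≡a , bba≡b) = ⁻¹-unique
      (trans (sym (ι-*³ a a b)) (ι-cong-mod aab≡a))
      (trans (sym (ι-*³ b b a)) (ι-cong-mod bba≡b))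

module Presentations where

  open import Data.Nat as ℕ using (ℕ; NonZero; _%_; _∸_)
  open import Data.Nat.DivMod using (_mod_; m<n⇒m%n≡m)
  open import Data.Fin using (Fin; toℕ)
  import Data.Fin.Properties as Fin
  open import Data.Product using (∃; _,_; proj₁; proj₂)
  open import Relation.Binary.PropositionalEquality as ≡ using (_≡_)
  open import Function.Bundles using (Bijection)
  open import Relation.Binary.Bundles using (Setoid)
  open ModularArithmetic using (mod-≡⇒%-≡)
  open Fermat using (GenInverseMod)

  -- ⟦_⟧ induces an isomorphism of ℕ/Nℕ onto A, compatible with generalized inverses computed modulo N.
  record Presentation {a ℓ} (A : RawMeadow a ℓ) (N : ℕ) .{{_ : NonZero N}} : Set (a ⊔ ℓ) where
    open RawMeadow A
    field
      ⟦_⟧           : ℕ → Carrier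
      ⟦⟧-cong       : ∀ {a b} → a % N ≡ b % N → ⟦ a ⟧ ≈ ⟦ b ⟧
      ⟦⟧-injective  : ∀ {a b} → ⟦ a ⟧ ≈ ⟦ b ⟧ → a % N ≡ b % N
      ⟦⟧-surjective : ∀ x → ∃ λ a → ⟦ a ⟧ ≈ x
      ⟦⟧-+          : ∀ a b → ⟦ a ℕ.+ b ⟧ ≈ ⟦ a ⟧ + ⟦ b ⟧
      ⟦⟧-*          : ∀ a b → ⟦ a ℕ.* b ⟧ ≈ ⟦ a ⟧ * ⟦ b ⟧
      ⟦⟧--          : ∀ a → ⟦ (N ∸ 1) ℕ.* a ⟧ ≈ - ⟦ a ⟧
      ⟦⟧-⁻¹         : ∀ {a b} → GenInverseMod N a b → ⟦ b ⟧ ≈ ⟦ a ⟧ ⁻¹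
      ⟦⟧-0          : ⟦ 0 ⟧ ≈ 0#
      ⟦⟧-1          : ⟦ 1 ⟧ ≈ 1#

  cast : ∀ {a ℓ} {A : RawMeadow a ℓ} {N N′} .{{_ : NonZero N}} .{{_ : NonZero N′}} →
         N ≡ N′ → Presentation A N → Presentation A N′
  cast ≡.refl P = P

  module _ {c ℓ c′ ℓ′} (M : Meadow c ℓ) {B : RawMeadow c′ ℓ′} {N} .{{_ : NonZero N}}
           (P : Presentation (Meadow.raw M) N) (Q : Presentation B N) where

    private
      module B = RawMeadow B
      module P = Presentation P
      module Q = Presentation Q
    open Meadow M
    open import Function.Consequences.Setoid setoid B.setoid using (strictlySurjective⇒surjective)
    open import Relation.Binary.Structures using (IsEquivalence)
    open IsEquivalence B.isEquivalence using () renaming (trans to transB)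

    index : Carrier → ℕ
    index x = proj₁ (P.⟦⟧-surjective x)

    ⟦index⟧ : ∀ x → x ≈ P.⟦ index x ⟧
    ⟦index⟧ x = sym (proj₂ (P.⟦⟧-surjective x))

    φ : Carrier → B.Carrier
    φ x = Q.⟦ index x ⟧

    φ-⟦⟧ : ∀ {x} a → x ≈ P.⟦ a ⟧ → φ x B.≈ Q.⟦ a ⟧
    φ-⟦⟧ {x} a x≈⟦a⟧ = Q.⟦⟧-cong (P.⟦⟧-injective (trans (sym (⟦index⟧ x)) x≈⟦a⟧))

    φ-cong : ∀ {x y} → x ≈ y → φ x B.≈ φ y
    φ-cong {y = y} x≈y = φ-⟦⟧ (index y) (trans x≈y (⟦index⟧ y))

    φ-injective : ∀ {x y} → φ x B.≈ φ y → x ≈ y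
    φ-injective {x} {y} φx≈φy =
      trans (⟦index⟧ x) (trans (P.⟦⟧-cong (Q.⟦⟧-injective φx≈φy)) (sym (⟦index⟧ y)))

    φ-strictlySurjective : ∀ y → ∃ λ x → φ x B.≈ y
    φ-strictlySurjective y = let (b , ⟦b⟧≈y) = Q.⟦⟧-surjective y in
      P.⟦ b ⟧ , transB (φ-⟦⟧ b refl) ⟦b⟧≈y

    φ-⁻¹ : ∀ x → φ (x ⁻¹) B.≈ φ x B.⁻¹
    φ-⁻¹ x = Q.⟦⟧-⁻¹ (P.⟦⟧-injective ⟦aab⟧≈⟦a⟧ , P.⟦⟧-injective ⟦bba⟧≈⟦b⟧)
      where
      a b : ℕ
      a = index x
      b = index (x ⁻¹)
      x≈⟦a⟧ : x ≈ P.⟦ a ⟧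
      x≈⟦a⟧ = ⟦index⟧ x
      x⁻¹≈⟦b⟧ : x ⁻¹ ≈ P.⟦ b ⟧
      x⁻¹≈⟦b⟧ = ⟦index⟧ (x ⁻¹)
      ⟦aab⟧≈⟦a⟧ : P.⟦ a ℕ.* a ℕ.* b ⟧ ≈ P.⟦ a ⟧
      ⟦aab⟧≈⟦a⟧ = trans (trans (P.⟦⟧-* _ b) (*-cong (P.⟦⟧-* a a) refl))
                    (trans (sym (*-cong (*-cong x≈⟦a⟧ x≈⟦a⟧) x⁻¹≈⟦b⟧)) (trans (inv-law₁ x) x≈⟦a⟧))
      ⟦bba⟧≈⟦b⟧ : P.⟦ b ℕ.* b ℕ.* a ⟧ ≈ P.⟦ b ⟧
      ⟦bba⟧≈⟦b⟧ = trans (trans (P.⟦⟧-* _ a) (*-cong (P.⟦⟧-* b b) refl))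
                    (trans (sym (*-cong (*-cong x⁻¹≈⟦b⟧ x⁻¹≈⟦b⟧) x≈⟦a⟧)) (trans (inv-law₂ x) x⁻¹≈⟦b⟧))

    φ-+ : ∀ x y → φ (x + y) B.≈ φ x B.+ φ y
    φ-+ x y = transB (φ-⟦⟧ _ (trans (+-cong (⟦index⟧ x) (⟦index⟧ y)) (sym (P.⟦⟧-+ _ _)))) (Q.⟦⟧-+ _ _)

    φ-* : ∀ x y → φ (x * y) B.≈ φ x B.* φ y
    φ-* x y = transB (φ-⟦⟧ _ (trans (*-cong (⟦index⟧ x) (⟦index⟧ y)) (sym (P.⟦⟧-* _ _)))) (Q.⟦⟧-* _ _)

    φ-- : ∀ x → φ (- x) B.≈ B.- φ x
    φ-- x = transB (φ-⟦⟧ _ (trans (-‿cong (⟦index⟧ x)) (sym (P.⟦⟧-- _)))) (Q.⟦⟧-- _)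

    presentations⇒≅ : Meadow.raw M ≅ B
    presentations⇒≅ = record
      { bijection = record
        { to        = φ
        ; cong      = φ-cong
        ; bijective = φ-injective , strictlySurjective⇒surjective φ-cong φ-strictlySurjective
        }
      ; to-+  = φ-+
      ; to-*  = φ-*
      ; to--  = φ--
      ; to-⁻¹ = φ-⁻¹
      ; to-0  = transB (φ-⟦⟧ 0 (sym P.⟦⟧-0)) Q.⟦⟧-0
      ; to-1  = transB (φ-⟦⟧ 1 (sym P.⟦⟧-1)) Q.⟦⟧-1
      }

  module _ {a ℓ n N} {A : RawMeadow a ℓ} .{{_ : NonZero N}} (P : Presentation A N)
           (card : Bijection (RawMeadow.setoid A) (≡.setoid (Fin n))) where

    private
      module A = Setoid (RawMeadow.setoid A)
      module P = Presentation P
      module card = Bijection card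

    presentation-modulus≡cardinality : N ≡ n
    presentation-modulus≡cardinality = Fin.cantor-schröder-bernstein {f = f} {g = g} f-injective g-injective
      where
      open ≡.≡-Reasoning
      f : Fin N → Fin n
      f i = card.to P.⟦ toℕ i ⟧
      f-injective : ∀ {i j} → f i ≡ f j → i ≡ j
      f-injective {i} {j} fi≡fj = Fin.toℕ-injective (begin
        toℕ i        ≡⟨ m<n⇒m%n≡m (Fin.toℕ<n i) ⟨
        toℕ i % N    ≡⟨ P.⟦⟧-injective (card.injective fi≡fj) ⟩
        toℕ j % N    ≡⟨ m<n⇒m%n≡m (Fin.toℕ<n j) ⟩
        toℕ j        ∎)
      from : Fin n → A.Carrier
      from j = proj₁ (card.strictlySurjective j)
      representative : A.Carrier → ℕ
      representative x = proj₁ (P.⟦⟧-surjective x)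
      g : Fin n → Fin N
      g j = representative (from j) mod N
      g-injective : ∀ {i j} → g i ≡ g j → i ≡ j
      g-injective {i} {j} gi≡gj = begin
        i                  ≡⟨ proj₂ (card.strictlySurjective i) ⟨
        card.to (from i)   ≡⟨ card.cong from-i≈from-j ⟩
        card.to (from j)   ≡⟨ proj₂ (card.strictlySurjective j) ⟩
        j                  ∎
        where
        from-i≈from-j : from i A.≈ from j
        from-i≈from-j = A.trans (A.sym (proj₂ (P.⟦⟧-surjective (from i))))
          (A.trans (P.⟦⟧-cong (mod-≡⇒%-≡ gi≡gj)) (proj₂ (P.⟦⟧-surjective (from j))))

module FiniteMeadows where

  open import Data.Nat as ℕ using (ℕ; zero; suc; NonZero; _%_; _∸_; _<_; s<s⁻¹; s≤s⁻¹; nonTrivial⇒n>1)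
  open import Data.Nat.Properties using (n<1+n; +-suc; m+[n∸m]≡n; <-cmp; ≤-<-trans; m∸n≤m; <⇒≱; m*n≢0; m<m*n)
  import Data.Nat.Properties as ℕₚ
  open import Data.Nat.DivMod using (_mod_; m%n<n; m*n%n≡0)
  open import Data.Nat.Divisibility using (_∣_; divides; ∣⇒≤; m%n≡0⇒n∣m)
  open import Data.Nat.Primality using (Prime; prime⇒nonZero; prime⇒nonTrivial)
  open import Data.Nat.Tactic.RingSolver using (solve-∀)
  open import Data.Fin using (Fin; toℕ)
  import Data.Fin.Properties as Fin
  open import Data.Product using (∃; ∃₂; _×_; _,_; proj₁; proj₂)
  open import Data.Empty using (⊥-elim)
  open import Level using (Lift; lift)
  open import Relation.Binary using (Setoid; Decidable; tri<; tri≈; tri>)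
  open import Relation.Binary.PropositionalEquality as ≡ using (_≡_)
  open import Relation.Nullary using (¬_; yes; no)
  import Relation.Nullary.Decidable as Dec
  open import Relation.Unary using (Pred)
  import Relation.Unary
  open import Function using (_∘′_)
  open import Function.Bundles using (Injection; Bijection)
  open ModularArithmetic using (toℕ-mod)
  open Presentations

  minimal-witness : ∀ {p} {P : ℕ → Set p} → Relation.Unary.Decidable P → ∀ {b} → P b →
                    ∃ λ c → P c × (∀ {d} → d < c → ¬ P d)
  minimal-witness P? {zero}  P0 = zero , P0 , λ ()
  minimal-witness P? {suc b} Pb with P? 0
  ... | yes P0 = zero , P0 , λ ()
  ... | no ¬P0 with c , Pc , below ← minimal-witness (λ d → P? (suc d)) Pb =
    suc c , Pc , λ { {zero} _ → ¬P0 ; {suc d} d<c → below (s<s⁻¹ d<c) }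

  Fin⇒nonZero : ∀ {n} → Fin n → NonZero n
  Fin⇒nonZero {suc _} _ = _

  repetition : ∀ {a ℓ n} {S : Setoid a ℓ} → Injection S (≡.setoid (Fin n)) →
               (f : ℕ → Setoid.Carrier S) → ∃₂ λ i d → Setoid._≈_ S (f i) (f (i ℕ.+ suc d))
  repetition {n = n} {S} inj f with i , j , i<j , fi≡fj ← Fin.pigeonhole (n<1+n n) (Injection.to inj ∘′ f ∘′ toℕ) =
    toℕ i , toℕ j ∸ suc (toℕ i) ,
    S.trans (Injection.injective inj fi≡fj) (S.reflexive (≡.cong f (≡.sym (≡.trans (+-suc (toℕ i) _) (m+[n∸m]≡n i<j)))))
    where module S = Setoid S

  module _ {c ℓ} (M : Meadow c ℓ) where

    open Meadow M
    open MeadowProperties M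
    open import Algebra.Properties.Semiring.Mult semiring using (×-homo-1; ×-homo-+; ×1-homo-*)
    open import Algebra.Properties.Semiring.Exp semiring using (_^_; ^-congˡ)
    open import Algebra.Properties.Ring ring using (+-identityʳ-unique)
    open import Relation.Binary.Reasoning.Setoid setoid

    ι-presentation : ∀ {N} .{{_ : NonZero N}} → ι N ≈ 0# → (∀ {a b} → ι a ≈ ι b → a % N ≡ b % N) →
                     (∀ x → ∃ λ a → ι a ≈ x) → Presentation raw N
    ι-presentation {N} ιN≈0 ι-injective ι-surjective = record
      { ⟦_⟧           = ι
      ; ⟦⟧-cong       = ι-cong-mod N ιN≈0
      ; ⟦⟧-injective  = ι-injective
      ; ⟦⟧-surjective = ι-surjective
      ; ⟦⟧-+          = ×-homo-+ 1#
      ; ⟦⟧-*          = ×1-homo-*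
      ; ⟦⟧--          = ι-neg N ιN≈0
      ; ⟦⟧-⁻¹         = ι-genInverse N ιN≈0
      ; ⟦⟧-0          = refl
      ; ⟦⟧-1          = ×-homo-1 1#
      }

    -- If p² ∣ N then m = N/p is nonzero modulo N while m² ≡ 0; but meadows have no nonzero nilpotents.
    presentation⇒squarefree : ∀ {N} .{{_ : NonZero N}} → Presentation raw N →
                              ∀ {p} → Prime p → ¬ p ℕ.* p ∣ N
    presentation⇒squarefree {N} P {p} p-prime (divides q N≡q*[p*p]) = <⇒≱ m<N (∣⇒≤ N∣m)
      where
      module P = Presentation P
      instance
        p≢0 : NonZero p
        p≢0 = prime⇒nonZero p-prime
        q≢0 : NonZero q
        q≢0 = ℕ.≢-nonZero λ q≡0 → ℕ.≢-nonZero⁻¹ N (≡.trans N≡q*[p*p] (≡.cong (ℕ._* (p ℕ.* p)) q≡0))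
        m≢0 : NonZero (q ℕ.* p)
        m≢0 = m*n≢0 q p
      m : ℕ
      m = q ℕ.* p
      m*p≡N : m ℕ.* p ≡ N
      m*p≡N = ≡.trans (ℕₚ.*-assoc q p p) (≡.sym N≡q*[p*p])
      m<N : m < N
      m<N = ≡.subst (m <_) m*p≡N (m<m*n m p (nonTrivial⇒n>1 p {{prime⇒nonTrivial p-prime}}))
      m*m≡q*N : m ℕ.* m ≡ q ℕ.* N
      m*m≡q*N = ≡.trans (square-reassoc q p) (≡.cong (q ℕ.*_) m*p≡N)
        where
        square-reassoc : ∀ a b → a ℕ.* b ℕ.* (a ℕ.* b) ≡ a ℕ.* (a ℕ.* b ℕ.* b)
        square-reassoc = solve-∀
      ⟦m⟧*⟦m⟧≈0 : P.⟦ m ⟧ * P.⟦ m ⟧ ≈ 0#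
      ⟦m⟧*⟦m⟧≈0 = begin
        P.⟦ m ⟧ * P.⟦ m ⟧    ≈⟨ P.⟦⟧-* m m ⟨
        P.⟦ m ℕ.* m ⟧        ≈⟨ P.⟦⟧-cong (≡.trans (≡.cong (_% N) m*m≡q*N) (≡.trans (m*n%n≡0 q N) (≡.sym (m*n%n≡0 0 N)))) ⟩
        P.⟦ 0 ⟧              ≈⟨ P.⟦⟧-0 ⟩
        0#                   ∎
      N∣m : N ∣ m
      N∣m = m%n≡0⇒n∣m m N (≡.trans (P.⟦⟧-injective (trans (x*x≈0⇒x≈0 ⟦m⟧*⟦m⟧≈0) (sym P.⟦⟧-0))) (m*n%n≡0 0 N))

    module _ {n} (card : HasCardinality M n) where

      private
        module card = Bijection card

      _≟_ : Decidable _≈_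
      x ≟ y = Dec.map′ card.injective card.cong (card.to x Fin.≟ card.to y)

      ι-periodic : ∃ λ d → ι (suc d) ≈ 0#
      ι-periodic with i , d , ιi≈ι[i+1+d] ← repetition card.injection ι =
        d , +-identityʳ-unique (ι i) _ (sym (trans ιi≈ι[i+1+d] (×-homo-+ 1# i (suc d))))

      x*x*x^d≈x : ∀ x → ∃ λ d → x * x * x ^ d ≈ x
      x*x*x^d≈x x with i , d , x^[1+i]≈x^[1+i+1+d] ← repetition card.injection (λ k → x ^ suc k) =
        d , x^[1+i]≈x^[1+i+1+d]⇒x*x*x^d≈x x i d x^[1+i]≈x^[1+i+1+d]

      private
        least-period : ∃ λ c → ι (suc c) ≈ 0# × (∀ {d} → d < c → ¬ ι (suc d) ≈ 0#)
        least-period = minimal-witness {P = λ d → ι (suc d) ≈ 0#} (λ d → ι (suc d) ≟ 0#) {proj₁ ι-periodic} (proj₂ ι-periodic)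

      char : ℕ
      char = suc (proj₁ least-period)

      ι-char≈0 : ι char ≈ 0#
      ι-char≈0 = proj₁ (proj₂ least-period)

      ι≉ι-below-char : ∀ {a b} → a < b → b < char → ¬ ι a ≈ ι b
      ι≉ι-below-char {a} {suc b} a<1+b 1+b<char ιa≈ι[1+b] =
        proj₂ (proj₂ least-period) (≤-<-trans (m∸n≤m b a) (s<s⁻¹ 1+b<char)) ι[1+b∸a]≈0
        where
        ι[1+b∸a]≈0 : ι (suc (b ∸ a)) ≈ 0#
        ι[1+b∸a]≈0 = +-identityʳ-unique (ι a) _ (sym (begin
          ι a                        ≈⟨ ιa≈ι[1+b] ⟩
          ι (suc b)                  ≡⟨ ≡.cong (ι ∘′ suc) (m+[n∸m]≡n (s≤s⁻¹ a<1+b)) ⟨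
          ι (suc (a ℕ.+ (b ∸ a)))    ≡⟨ ≡.cong ι (+-suc a (b ∸ a)) ⟨
          ι (a ℕ.+ suc (b ∸ a))      ≈⟨ ×-homo-+ 1# a (suc (b ∸ a)) ⟩
          ι a + ι (suc (b ∸ a))      ∎))

      ι-injective-below-char : ∀ {a b} → a < char → b < char → ι a ≈ ι b → a ≡ b
      ι-injective-below-char {a} {b} a<char b<char ιa≈ιb with <-cmp a b
      ... | tri< a<b _ _ = ⊥-elim (ι≉ι-below-char a<b b<char ιa≈ιb)
      ... | tri≈ _ a≡b _ = a≡b
      ... | tri> _ _ b<a = ⊥-elim (ι≉ι-below-char b<a a<char (sym ιa≈ιb))

      ι-≈⇒%-≡ : ∀ {a b} → ι a ≈ ι b → a % char ≡ b % char
      ι-≈⇒%-≡ {a} {b} ιa≈ιb = ι-injective-below-char (m%n<n a char) (m%n<n b char)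
        (trans (sym (ι-mod char ι-char≈0 a)) (trans ιa≈ιb (ι-mod char ι-char≈0 b)))

      Image-ι : Pred Carrier (c ⊔ ℓ)
      Image-ι x = Lift c (∃ λ a → ι a ≈ x)

      image-ι-isSubmeadow : IsSubmeadow M Image-ι
      image-ι-isSubmeadow = record
        { resp  = λ { x≈y (lift (a , ιa≈x)) → lift (a , trans ιa≈x x≈y) }
        ; has-0 = lift (0 , refl)
        ; has-1 = lift (1 , ×-homo-1 1#)
        ; cl-+  = λ { (lift (a , ιa≈x)) (lift (b , ιb≈y)) → lift (a ℕ.+ b , trans (×-homo-+ 1# a b) (+-cong ιa≈x ιb≈y)) }
        ; cl-*  = λ { (lift (a , ιa≈x)) (lift (b , ιb≈y)) → lift (a ℕ.* b , trans (×1-homo-* a b) (*-cong ιa≈x ιb≈y)) }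
        ; cl--  = λ { (lift (a , ιa≈x)) → lift ((char ∸ 1) ℕ.* a , trans (ι-neg char ι-char≈0 a) (-‿cong ιa≈x)) }
        ; cl-⁻¹ = λ { (lift (a , ιa≈x)) → lift (ι-inverse a ιa≈x) }
        }
        where
        ι-inverse : ∀ {x} a → ι a ≈ x → ∃ λ b → ι b ≈ x ⁻¹
        ι-inverse {x} a ιa≈x with d , xxu≈x ← x*x*x^d≈x x = a ℕ.^ d ℕ.* a ℕ.^ d ℕ.* a , (begin
          ι (a ℕ.^ d ℕ.* a ℕ.^ d ℕ.* a)  ≈⟨ ι-*³ (a ℕ.^ d) (a ℕ.^ d) a ⟩
          ι (a ℕ.^ d) * ι (a ℕ.^ d) * ι a ≈⟨ *-cong (*-cong ι[a^d]≈x^d ι[a^d]≈x^d) ιa≈x ⟩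
          x ^ d * x ^ d * x              ≈⟨ x*x*u≈x⇒x⁻¹≈u*u*x xxu≈x ⟨
          x ⁻¹                           ∎)
          where
          ι[a^d]≈x^d : ι (a ℕ.^ d) ≈ x ^ d
          ι[a^d]≈x^d = trans (ι-^ a d) (^-congˡ d ιa≈x)

      minimal⇒ι-surjective : IsMinimal M → ∀ x → ∃ λ a → ι a ≈ x
      minimal⇒ι-surjective minimal x with Fin.any? (λ (i : Fin char) → ι (toℕ i) ≟ x)
      ... | yes (i , ιi≈x) = toℕ i , ιi≈x
      ... | no ∄i = ⊥-elim (minimal Image-ι image-ι-isSubmeadow (x , x∉Image-ι))
        where
        x∉Image-ι : ¬ Image-ι x
        x∉Image-ι (lift (a , ιa≈x)) = ∄i (a mod char ,
          trans (reflexive (≡.cong ι (toℕ-mod a char))) (trans (sym (ι-mod char ι-char≈0 a)) ιa≈x))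

      cardinality-nonZero : NonZero n
      cardinality-nonZero = Fin⇒nonZero (card.to 0#)

      minimal⇒presentation : (minimal : IsMinimal M) → Presentation raw n {{cardinality-nonZero}}
      minimal⇒presentation minimal =
        cast {{_}} {{cardinality-nonZero}} (presentation-modulus≡cardinality P card) P
        where
        P : Presentation raw char
        P = ι-presentation ι-char≈0 (λ {a} {b} → ι-≈⇒%-≡ {a} {b}) (minimal⇒ι-surjective minimal)

module PrimeProducts where

  open import Data.Nat as ℕ using (ℕ; zero; suc; NonZero; _%_; _∸_; _+_; _*_; _^_)
  open import Data.Nat.Properties using (+-comm; *-comm; m∸n+n≡m; 1+n≰n; 1+n≢0; m*n≢0; <⇒≤)
  open import Data.Nat.DivMod using (_mod_; m%n%n≡m%n; n%n≡0; m<n⇒m%n≡m)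
  open import Data.Nat.Divisibility using (_∣_; divides; ∣m⇒∣m*n; ∣n⇒∣m*n; m∣m*n; *-monoˡ-∣; *-monoʳ-∣; n∣m⇒m%n≡0; m%n≡0⇒n∣m; ∣1⇒≡1; 1∣_)
  open import Data.Nat.Primality using (Prime; prime⇒nonZero; euclidsLemma; prime⇒irreducible; ¬prime[1])
  open import Data.Fin using (Fin; toℕ; combine; punchOut) renaming (zero to fzero; suc to fsuc)
  import Data.Fin.Properties as Fin
  open import Data.Product using (∃; _,_; proj₁; proj₂)
  open import Data.Sum using (inj₁; inj₂)
  open import Relation.Nullary using (¬_; yes; no; contradiction)
  open import Relation.Binary.PropositionalEquality
  open import Data.Nat.Primality.Factorisation using (PrimeFactorisation; factorise)
  open import Data.Nat.ListAction using (product)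
  open import Data.List as List using ([]; _∷_)
  import Data.List.Relation.Unary.All as All
  open import Data.List.Membership.Propositional.Properties using (∈-lookup)
  open import Function using (_∘_)
  open import Function.Bundles using (Bijection)
  open ModularArithmetic
  open Fermat
  open Presentations

  module ZModHomomorphism (q : ℕ) .{{_ : NonZero q}} where

    open ZMod q

    %-toℕ-mod : ∀ a → toℕ (a mod q) % q ≡ a % q
    %-toℕ-mod a = trans (cong (_% q) (toℕ-mod a q)) (m%n%n≡m%n a q)

    mod-+ : ∀ a b → (a + b) mod q ≡ (a mod q) +q (b mod q)
    mod-+ a b = %-≡⇒mod-≡ (%-cong-+ (sym (%-toℕ-mod a)) (sym (%-toℕ-mod b)))

    mod-* : ∀ a b → (a * b) mod q ≡ (a mod q) *q (b mod q)
    mod-* a b = %-≡⇒mod-≡ (%-cong-* (sym (%-toℕ-mod a)) (sym (%-toℕ-mod b)))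

    mod-neg : ∀ N .{{_ : NonZero N}} → q ∣ N → ∀ a → ((N ∸ 1) * a) mod q ≡ -q (a mod q)
    mod-neg (suc N) q∣1+N a = %-≡⇒mod-≡ (%-cancelʳ-+ {a = N * a} {b = q ∸ toℕ (a mod q)} a (begin
      (N * a + a) % q                     ≡⟨ cong (_% q) (+-comm (N * a) a) ⟩
      (suc N * a) % q                     ≡⟨ n∣m⇒m%n≡0 _ q (∣m⇒∣m*n a q∣1+N) ⟩
      0                                   ≡⟨ n%n≡0 q ⟨
      q % q                               ≡⟨ cong (_% q) (m∸n+n≡m (<⇒≤ (Fin.toℕ<n (a mod q)))) ⟨
      (q ∸ toℕ (a mod q) + toℕ (a mod q)) % q ≡⟨ %-cong-+ {a = q ∸ toℕ (a mod q)} refl (%-toℕ-mod a) ⟩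
      (q ∸ toℕ (a mod q) + a) % q         ∎))
      where open ≡-Reasoning

    -- invq uses Fermat's exponent q ∸ 2, which is the inverse only because of Fermat's little theorem.
    mod-⁻¹ : Prime q → ∀ {a b} → GenInverseMod q a b → b mod q ≡ invq (a mod q)
    mod-⁻¹ q-prime {a} {b} inverse with a mod q in a-mod-q
    ... | fzero  = Fin.toℕ-injective (trans (toℕ-mod b q) (genInverse-of-multiple q∣a inverse))
      where
      q∣a : q ∣ a
      q∣a = m%n≡0⇒n∣m a q (trans (sym (toℕ-mod a q)) (cong toℕ a-mod-q))
    ... | fsuc i = %-≡⇒mod-≡ {a = b} {b = suc (toℕ i) ^ (q ∸ 2)}
      (trans (genInverse-of-unit q-prime q∤a inverse) (%-cong-^ (q ∸ 2) a%q≡1+i))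
      where
      a%q≡1+i : a % q ≡ suc (toℕ i) % q
      a%q≡1+i = trans (sym (%-toℕ-mod a)) (cong (λ j → toℕ j % q) a-mod-q)
      q∤a : ¬ q ∣ a
      q∤a q∣a = 1+n≢0 (trans (sym (cong toℕ a-mod-q)) (trans (toℕ-mod a q) (n∣m⇒m%n≡0 a q q∣a)))

  ∏-nonZero : ∀ {k} (p : Fin k → ℕ) → (∀ i → NonZero (p i)) → NonZero (∏ p)
  ∏-nonZero {zero}  p p≢0 = _
  ∏-nonZero {suc k} p p≢0 = m*n≢0 (p fzero) (∏ (p ∘ fsuc)) {{p≢0 fzero}} {{∏-nonZero (p ∘ fsuc) (p≢0 ∘ fsuc)}}

  ∣∏ : ∀ {k} (p : Fin k → ℕ) i → p i ∣ ∏ p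
  ∣∏ p fzero    = m∣m*n _
  ∣∏ p (fsuc i) = ∣n⇒∣m*n (p fzero) (∣∏ (p ∘ fsuc) i)

  *∣∏ : ∀ {k} (p : Fin k → ℕ) {i j} → i ≢ j → p i * p j ∣ ∏ p
  *∣∏ p {fzero}  {fzero}  0≢0 = contradiction refl 0≢0
  *∣∏ p {fzero}  {fsuc j} _   = *-monoʳ-∣ (p fzero) (∣∏ (p ∘ fsuc) j)
  *∣∏ p {fsuc i} {fzero}  _   = subst (_∣ ∏ p) (*-comm (p fzero) (p (fsuc i))) (*-monoʳ-∣ (p fzero) (∣∏ (p ∘ fsuc) i))
  *∣∏ p {fsuc i} {fsuc j} i≢j = ∣n⇒∣m*n (p fzero) (*∣∏ (p ∘ fsuc) (i≢j ∘ cong fsuc))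

  prime∣∏ : ∀ {k} {p : Fin k → ℕ} → (∀ i → Prime (p i)) → ∀ {q} → Prime q → q ∣ ∏ p → ∃ λ i → q ≡ p i
  prime∣∏ {zero}      p-prime q-prime q∣1 = contradiction (subst Prime (∣1⇒≡1 q∣1) q-prime) ¬prime[1]
  prime∣∏ {suc k} {p} p-prime q-prime q∣∏ with euclidsLemma (p fzero) (∏ (p ∘ fsuc)) q-prime q∣∏
  ... | inj₂ q∣∏′ with i , q≡pi ← prime∣∏ (p-prime ∘ fsuc) q-prime q∣∏′ = fsuc i , q≡pi
  ... | inj₁ q∣p₀ with prime⇒irreducible (p-prime fzero) q∣p₀
  ...   | inj₁ q≡1  = contradiction (subst Prime q≡1 q-prime) ¬prime[1]
  ...   | inj₂ q≡p₀ = fzero , q≡p₀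

  ∏∣ : ∀ {k} {p : Fin k → ℕ} → (∀ i → Prime (p i)) → (∀ i j → p i ≡ p j → i ≡ j) →
       ∀ {d} → (∀ i → p i ∣ d) → ∏ p ∣ d
  ∏∣ {zero}  p-prime p-distinct p∣d = 1∣ _
  ∏∣ {suc k} {p} p-prime p-distinct {d} p∣d
    with divides t d≡t*∏′ ← ∏∣ (p-prime ∘ fsuc) (λ i j pi≡pj → Fin.suc-injective (p-distinct _ _ pi≡pj)) (p∣d ∘ fsuc)
    with euclidsLemma t (∏ (p ∘ fsuc)) (p-prime fzero) (subst (p fzero ∣_) d≡t*∏′ (p∣d fzero))
  ... | inj₁ p₀∣t = subst (p fzero * ∏ (p ∘ fsuc) ∣_) (sym d≡t*∏′) (*-monoˡ-∣ (∏ (p ∘ fsuc)) p₀∣t)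
  ... | inj₂ p₀∣∏′ with i , p₀≡pi ← prime∣∏ (p-prime ∘ fsuc) (p-prime fzero) p₀∣∏′ =
    contradiction (p-distinct fzero (fsuc i) p₀≡pi) λ ()

  encode : ∀ {k} (p : Fin k → ℕ) → ((i : Fin k) → Fin (p i)) → Fin (∏ p)
  encode {zero}  p x = fzero
  encode {suc k} p x = combine (x fzero) (encode (p ∘ fsuc) (x ∘ fsuc))

  encode-injective : ∀ {k} (p : Fin k → ℕ) {x y : (i : Fin k) → Fin (p i)} → encode p x ≡ encode p y → ∀ i → x i ≡ y i
  encode-injective p {x} {y} ex≡ey fzero    = proj₁ (Fin.combine-injective (x fzero) _ (y fzero) _ ex≡ey)
  encode-injective p {x} {y} ex≡ey (fsuc i) =
    encode-injective (p ∘ fsuc) (proj₂ (Fin.combine-injective (x fzero) _ (y fzero) _ ex≡ey)) i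

  injective⇒surjective : ∀ {n} (f : Fin n → Fin n) → (∀ {i j} → f i ≡ f j → i ≡ j) → ∀ y → ∃ λ x → f x ≡ y
  injective⇒surjective {suc n} f f-injective y with Fin.any? (λ x → f x Fin.≟ y)
  ... | yes found = found
  ... | no ∄x = contradiction (Fin.injective⇒≤ f-without-y-injective) 1+n≰n
    where
    y≢f : ∀ x → y ≢ f x
    y≢f x y≡fx = ∄x (x , sym y≡fx)
    f-without-y-injective : ∀ {i j} → punchOut (y≢f i) ≡ punchOut (y≢f j) → i ≡ j
    f-without-y-injective = f-injective ∘ Fin.punchOut-injective (y≢f _) (y≢f _)

  module _ {k} (p : Fin k → ℕ) (p-prime : ∀ i → Prime (p i)) (p-distinct : ∀ i j → p i ≡ p j → i ≡ j) where

    private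
      p≢0 : ∀ i → NonZero (p i)
      p≢0 i = prime⇒nonZero (p-prime i)
      module H (i : Fin k) = ZModHomomorphism (p i) {{p≢0 i}}

    instance
      ∏p≢0 : NonZero (∏ p)
      ∏p≢0 = ∏-nonZero p p≢0

    open RawMeadow (ZProd p p≢0)

    ⟦_⟧ : ℕ → Carrier
    ⟦ a ⟧ i = _mod_ a (p i) {{p≢0 i}}

    %-≡-∏ : ∀ {a b} i → a % ∏ p ≡ b % ∏ p → _%_ a (p i) {{p≢0 i}} ≡ _%_ b (p i) {{p≢0 i}}
    %-≡-∏ i = %-≡-∣ {{p≢0 i}} (∣∏ p i)

    ⟦⟧-injective : ∀ {a b} → ⟦ a ⟧ ≈ ⟦ b ⟧ → a % ∏ p ≡ b % ∏ p
    ⟦⟧-injective {a} {b} ⟦a⟧≈⟦b⟧ = ∣∣-∣⇒%-≡ a b (∏∣ p-prime p-distinct λ i → let instance _ = p≢0 i in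
      %-≡⇒∣∣-∣ a b (mod-≡⇒%-≡ (⟦a⟧≈⟦b⟧ i)))

    -- Chinese remainder theorem by counting: ⟦_⟧ is injective on Fin (∏ p), and encode embeds the
    -- tuples into Fin (∏ p).
    encode∘⟦⟧-injective : ∀ {a b : Fin (∏ p)} → encode p ⟦ toℕ a ⟧ ≡ encode p ⟦ toℕ b ⟧ → a ≡ b
    encode∘⟦⟧-injective {a} {b} e = Fin.toℕ-injective (begin
      toℕ a           ≡⟨ m<n⇒m%n≡m (Fin.toℕ<n a) ⟨
      toℕ a % ∏ p     ≡⟨ ⟦⟧-injective (encode-injective p e) ⟩
      toℕ b % ∏ p     ≡⟨ m<n⇒m%n≡m (Fin.toℕ<n b) ⟩
      toℕ b           ∎)
      where open ≡-Reasoning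

    ⟦⟧-surjective : ∀ x → ∃ λ a → ⟦ a ⟧ ≈ x
    ⟦⟧-surjective x
      with a , ⟦a⟧≡x ← injective⇒surjective (encode p ∘ ⟦_⟧ ∘ toℕ) encode∘⟦⟧-injective (encode p x) =
      toℕ a , encode-injective p ⟦a⟧≡x

    ZProd-presentation : Presentation (ZProd p p≢0) (∏ p)
    ZProd-presentation = record
      { ⟦_⟧           = ⟦_⟧
      ; ⟦⟧-cong       = λ a≡b i → let instance _ = p≢0 i in %-≡⇒mod-≡ (%-≡-∏ i a≡b)
      ; ⟦⟧-injective  = ⟦⟧-injective
      ; ⟦⟧-surjective = ⟦⟧-surjective
      ; ⟦⟧-+          = λ a b i → H.mod-+ i a b
      ; ⟦⟧-*          = λ a b i → H.mod-* i a b
      ; ⟦⟧--          = λ a i → H.mod-neg i (∏ p) (∣∏ p i) a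
      ; ⟦⟧-⁻¹         = λ (aab≡a , bba≡b) i → H.mod-⁻¹ i (p-prime i) (%-≡-∏ i aab≡a , %-≡-∏ i bba≡b)
      ; ⟦⟧-0          = λ i → refl
      ; ⟦⟧-1          = λ i → refl
      }

    module _ {c ℓ} (M : Meadow c ℓ) (I : Meadow.raw M ≅ ZProd p p≢0) where

      open Meadow M using () renaming (1# to 1ᴹ)
      open MeadowProperties M using (ι; ι-surjective⇒minimal)
      private
        module I = _≅_ I

      to-ι : ∀ a → I.to (ι a) ≈ ⟦ a ⟧
      to-ι zero    i = I.to-0 i
      to-ι (suc a) i = let instance _ = p≢0 i in
        trans (I.to-+ 1ᴹ (ι a) i) (trans (cong₂ (ZMod._+q_ (p i)) (I.to-1 i) (to-ι a i)) (sym (H.mod-+ i 1 a)))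

      ≅-ZProd⇒minimal : IsMinimal M
      ≅-ZProd⇒minimal = ι-surjective⇒minimal λ x → let (a , ⟦a⟧≈x) = ⟦⟧-surjective (I.to x) in
        a , Bijection.injective I.bijection λ i → trans (to-ι a i) (⟦a⟧≈x i)

  record DistinctPrimeFactorisation (n : ℕ) : Set where
    field
      {length}         : ℕ
      factor           : Fin length → ℕ
      factor-prime     : ∀ i → Prime (factor i)
      factor-injective : ∀ i j → factor i ≡ factor j → i ≡ j
      n≡∏factor        : n ≡ ∏ factor

  squarefree⇒distinctPrimeFactorisation : ∀ {n} .{{_ : NonZero n}} → (∀ {p} → Prime p → ¬ p * p ∣ n) →
                                          DistinctPrimeFactorisation n
  squarefree⇒distinctPrimeFactorisation {n} squarefree = record
    { factor           = p
    ; factor-prime     = λ i → All.lookup factorsPrime (∈-lookup i)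
    ; factor-injective = factor-injective
    ; n≡∏factor        = n≡∏p
    }
    where
    open PrimeFactorisation (factorise n)
    p : Fin (List.length factors) → ℕ
    p = List.lookup factors
    ∏-lookup : ∀ xs → ∏ (List.lookup xs) ≡ product xs
    ∏-lookup []       = refl
    ∏-lookup (x ∷ xs) = cong (x *_) (∏-lookup xs)
    n≡∏p : n ≡ ∏ p
    n≡∏p = trans isFactorisation (sym (∏-lookup factors))
    factor-injective : ∀ i j → p i ≡ p j → i ≡ j
    factor-injective i j pi≡pj with i Fin.≟ j
    ... | yes i≡j = i≡j
    ... | no i≢j  = contradiction pi*pi∣n (squarefree (All.lookup factorsPrime (∈-lookup i)))
      where
      pi*pi∣n : p i * p i ∣ n
      pi*pi∣n = subst₂ _∣_ (cong (p i *_) (sym pi≡pj)) (sym n≡∏p) (*∣∏ p i≢j)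

open Presentations using (Presentation; cast; presentations⇒≅)
open FiniteMeadows using (cardinality-nonZero; minimal⇒presentation; presentation⇒squarefree)
open PrimeProducts
  using (DistinctPrimeFactorisation; squarefree⇒distinctPrimeFactorisation; ∏p≢0; ZProd-presentation; ≅-ZProd⇒minimal)

PrimeProductDecomposition : ∀ {c ℓ} → Meadow c ℓ → ℕ → Set (c ⊔ ℓ)
PrimeProductDecomposition M n =
  Σ ℕ λ k → Σ (Fin k → ℕ) λ p → Σ (∀ i → Prime (p i)) λ pr →
    (∀ i j → p i ≡ p j → i ≡ j) ×
    (Meadow.raw M ≅ ZProd p (λ i → prime⇒nonZero (pr i))) ×
    (n ≡ ∏ p)

module _ {c ℓ} (M : Meadow c ℓ) {n} (card : HasCardinality M n) where

  instance
    _ : NonZero n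
    _ = cardinality-nonZero M card

  minimal⇒primeProductDecomposition : IsMinimal M → PrimeProductDecomposition M n
  minimal⇒primeProductDecomposition minimal =
    length , factor , factor-prime , factor-injective ,
    presentations⇒≅ M (cast n≡∏factor P) (ZProd-presentation factor factor-prime factor-injective) ,
    n≡∏factor
    where
    P : Presentation (Meadow.raw M) n
    P = minimal⇒presentation M card minimal
    open DistinctPrimeFactorisation (squarefree⇒distinctPrimeFactorisation (presentation⇒squarefree M P))
    instance
      _ : NonZero (∏ factor)
      _ = ∏p≢0 factor factor-prime factor-injective

mainTheorem3 : {c ℓ c′ ℓ′ : Level} →
    ((M : Meadow c ℓ) (n : ℕ) → HasCardinality M n →
      (IsMinimal M ⇔
        Σ ℕ λ k → Σ (Fin k → ℕ) λ p → Σ (∀ i → Prime (p i)) λ pr →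
          (∀ i j → p i ≡ p j → i ≡ j) ×
          (Meadow.raw M ≅ ZProd p (λ i → prime⇒nonZero (pr i))) ×
          (n ≡ ∏ p)))
    ×
    ((M : Meadow c ℓ) (N : Meadow c′ ℓ′) (n : ℕ) →
      HasCardinality M n → HasCardinality N n →
      IsMinimal M → IsMinimal N → Meadow.raw M ≅ Meadow.raw N)
mainTheorem3 = characterisation , uniqueness
  where
  characterisation : ∀ {c ℓ} (M : Meadow c ℓ) n → HasCardinality M n → IsMinimal M ⇔ PrimeProductDecomposition M n
  characterisation M n card = mk⇔ (minimal⇒primeProductDecomposition M card)
    λ (_ , p , p-prime , p-distinct , M≅ZProd , _) → ≅-ZProd⇒minimal p p-prime p-distinct M M≅ZProd
  uniqueness : ∀ {c ℓ c′ ℓ′} (M : Meadow c ℓ) (N : Meadow c′ ℓ′) n → HasCardinality M n → HasCardinality N n →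
               IsMinimal M → IsMinimal N → Meadow.raw M ≅ Meadow.raw N
  uniqueness M N n cardM cardN minimalM minimalN = let instance _ = cardinality-nonZero M cardM in
    presentations⇒≅ M (minimal⇒presentation M cardM minimalM) (minimal⇒presentation N cardN minimalN)
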